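{- Let $T$ be a rational number with $0<T<1$, and consider the right triangle with side lengths $(1-T^2,\,2T,\,1+T^2)$. Suppose that $1-T$ and $1+T$ are both squares of rational numbers. Then there exist rational numbers $u,v$ such that $(u,v,1)$ are the side lengths of a right triangle (so $u^2+v^2=1$, $u,v>0$) and $T=2uv$. Moreover, the ratio of the area of the triangle $(1-T^2,2T,1+T^2)$ to the area of the triangle $(u,v,1)$ is the square of a rational number. -}

module Defs where

open import Data.Rational using (ℚ; _*_; ½)

rightTriangleArea : ℚ → ℚ → ℚ
rightTriangleArea a b = ½ * a * b

{-# OPTIONS --safe #-}
module Submission where

open import Defs
open import Data.Rational using (ℚ; 0ℚ; 1ℚ; _+_; _-_; _*_; _<_; _≤_; -_; ∣_∣; ½; nonNegative)
open import Data.Rational.Properties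
open import Data.Rational.Solver using (module +-*-Solver)
open import Data.Product using (Σ; ∃; _×_; _,_)
open import Data.Sum using (inj₁; inj₂)
open import Relation.Binary.PropositionalEquality
open +-*-Solver

-- Let 1 - T = a² and 1 + T = b² with a, b ≥ 0. Then u = (b + a)/2 and
-- v = (b - a)/2 satisfy u² + v² = (a² + b²)/2 = 1 and 2uv = (b² - a²)/2 = T,
-- and b > a since b² - a² = 2T > 0. The big triangle has area
-- T(1 - T)(1 + T) = a²b²T, while the small one has area uv/2 = T/4, so the
-- ratio of areas is (2ab)².

∣p∣*∣p∣≡p*p : ∀ p → ∣ p ∣ * ∣ p ∣ ≡ p * p
∣p∣*∣p∣≡p*p p with ∣p∣≡p∨∣p∣≡-p p
... | inj₁ ∣p∣≡p  rewrite ∣p∣≡p  = refl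
... | inj₂ ∣p∣≡-p rewrite ∣p∣≡-p = solve 1 (λ x → (:- x) :* (:- x) := x :* x) refl p

nonNegSquareRoot : ∀ {p} → (∃ λ a → p ≡ a * a) → ∃ λ a → 0ℚ ≤ a × p ≡ a * a
nonNegSquareRoot (a , p≡a*a) = ∣ a ∣ , 0≤∣p∣ a , trans p≡a*a (sym (∣p∣*∣p∣≡p*p a))

*-self-<⇒<-nonNeg : ∀ {p q} → 0ℚ ≤ p → 0ℚ ≤ q → p * p < q * q → p < q
*-self-<⇒<-nonNeg {p} {q} 0≤p 0≤q p*p<q*q = ≰⇒> λ q≤p → <-irrefl refl (<-≤-trans p*p<q*q (q≤p⇒q*q≤p*p q≤p))
  where
  q≤p⇒q*q≤p*p : q ≤ p → q * q ≤ p * p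
  q≤p⇒q*q≤p*p q≤p = ≤-trans (*-monoʳ-≤-nonNeg q {{nonNegative 0≤q}} q≤p)
                            (*-monoˡ-≤-nonNeg p {{nonNegative 0≤p}} q≤p)

0<p⇒0<½*p : ∀ {p} → 0ℚ < p → 0ℚ < ½ * p
0<p⇒0<½*p {p} 0<p = subst (_< ½ * p) (*-zeroʳ ½) (*-monoʳ-<-pos ½ 0<p)

halfSum²+halfDiff² : ∀ a b → ½ * (b + a) * (½ * (b + a)) + ½ * (b - a) * (½ * (b - a)) ≡ ½ * (a * a + b * b)
halfSum²+halfDiff² = solve 2 (λ a b →
  con ½ :* (b :+ a) :* (con ½ :* (b :+ a)) :+ con ½ :* (b :- a) :* (con ½ :* (b :- a))
    := con ½ :* (a :* a :+ b :* b)) refl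

2*halfSum*halfDiff : ∀ a b → (1ℚ + 1ℚ) * (½ * (b + a)) * (½ * (b - a)) ≡ ½ * (b * b - a * a)
2*halfSum*halfDiff = solve 2 (λ a b →
  (con 1ℚ :+ con 1ℚ) :* (con ½ :* (b :+ a)) :* (con ½ :* (b :- a))
    := con ½ :* (b :* b :- a :* a)) refl

area-[1-T²,2T] : ∀ T → rightTriangleArea (1ℚ - T * T) ((1ℚ + 1ℚ) * T) ≡ (1ℚ - T) * (1ℚ + T) * T
area-[1-T²,2T] = solve 1 (λ T →
  con ½ :* (con 1ℚ :- T :* T) :* ((con 1ℚ :+ con 1ℚ) :* T)
    := (con 1ℚ :- T) :* (con 1ℚ :+ T) :* T) refl

[2ab]²*area : ∀ a b u v →
  ((1ℚ + 1ℚ) * a * b * ((1ℚ + 1ℚ) * a * b)) * rightTriangleArea u v ≡ (a * a) * (b * b) * ((1ℚ + 1ℚ) * u * v)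
[2ab]²*area = solve 4 (λ a b u v →
  ((con 1ℚ :+ con 1ℚ) :* a :* b :* ((con 1ℚ :+ con 1ℚ) :* a :* b)) :* (con ½ :* u :* v)
    := (a :* a) :* (b :* b) :* ((con 1ℚ :+ con 1ℚ) :* u :* v)) refl

module SquareRoots {T a b : ℚ} (1-T≡a² : 1ℚ - T ≡ a * a) (1+T≡b² : 1ℚ + T ≡ b * b) where
  open ≡-Reasoning

  ½[a²+b²]≡1 : ½ * (a * a + b * b) ≡ 1ℚ
  ½[a²+b²]≡1 = begin
    ½ * (a * a + b * b)         ≡⟨ cong₂ (λ x y → ½ * (x + y)) 1-T≡a² 1+T≡b² ⟨
    ½ * ((1ℚ - T) + (1ℚ + T))   ≡⟨ solve 1 (λ t → con ½ :* ((con 1ℚ :- t) :+ (con 1ℚ :+ t)) := con 1ℚ) refl T ⟩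
    1ℚ                          ∎

  ½[b²-a²]≡T : ½ * (b * b - a * a) ≡ T
  ½[b²-a²]≡T = begin
    ½ * (b * b - a * a)         ≡⟨ cong₂ (λ x y → ½ * (x - y)) 1+T≡b² 1-T≡a² ⟨
    ½ * ((1ℚ + T) - (1ℚ - T))   ≡⟨ solve 1 (λ t → con ½ :* ((con 1ℚ :+ t) :- (con 1ℚ :- t)) := t) refl T ⟩
    T                           ∎

  0<T⇒a<b : 0ℚ < T → 0ℚ ≤ a → 0ℚ ≤ b → a < b
  0<T⇒a<b 0<T 0≤a 0≤b = *-self-<⇒<-nonNeg 0≤a 0≤b (subst₂ _<_ 1-T≡a² 1+T≡b² 1-T<1+T)
    where
    1-T<1+T : 1ℚ - T < 1ℚ + T
    1-T<1+T = +-monoʳ-< 1ℚ (<-trans (neg-antimono-< 0<T) 0<T)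

  area-ratio : ∀ u v → (1ℚ + 1ℚ) * u * v ≡ T →
    rightTriangleArea (1ℚ - T * T) ((1ℚ + 1ℚ) * T) ≡ ((1ℚ + 1ℚ) * a * b * ((1ℚ + 1ℚ) * a * b)) * rightTriangleArea u v
  area-ratio u v 2uv≡T = begin
    rightTriangleArea (1ℚ - T * T) ((1ℚ + 1ℚ) * T)  ≡⟨ area-[1-T²,2T] T ⟩
    (1ℚ - T) * (1ℚ + T) * T                         ≡⟨ cong₂ (λ x y → x * y * T) 1-T≡a² 1+T≡b² ⟩
    (a * a) * (b * b) * T                           ≡⟨ cong ((a * a) * (b * b) *_) 2uv≡T ⟨
    (a * a) * (b * b) * ((1ℚ + 1ℚ) * u * v)         ≡⟨ [2ab]²*area a b u v ⟨
    ((1ℚ + 1ℚ) * a * b * ((1ℚ + 1ℚ) * a * b)) * rightTriangleArea u v ∎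

theorem2 : (T : ℚ) → 0ℚ < T → T < 1ℚ
    → (∃ λ a → 1ℚ - T ≡ a * a) → (∃ λ b → 1ℚ + T ≡ b * b)
    → Σ ℚ λ u → Σ ℚ λ v →
        (u * u + v * v ≡ 1ℚ) × (0ℚ < u) × (0ℚ < v) × (T ≡ (1ℚ + 1ℚ) * u * v)
        × (∃ λ r → rightTriangleArea (1ℚ - T * T) ((1ℚ + 1ℚ) * T) ≡ (r * r) * rightTriangleArea u v)
theorem2 T 0<T _ 1-T≡□ 1+T≡□
  with nonNegSquareRoot 1-T≡□ | nonNegSquareRoot 1+T≡□
... | a , 0≤a , 1-T≡a² | b , 0≤b , 1+T≡b² =
  u , v , trans (halfSum²+halfDiff² a b) ½[a²+b²]≡1 , 0<p⇒0<½*p 0<b+a , 0<p⇒0<½*p 0<b-a ,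
  sym 2uv≡T , (1ℚ + 1ℚ) * a * b , area-ratio u v 2uv≡T
  where
  open SquareRoots {T} {a} {b} 1-T≡a² 1+T≡b²
  u v : ℚ
  u = ½ * (b + a)
  v = ½ * (b - a)
  a<b : a < b
  a<b = 0<T⇒a<b 0<T 0≤a 0≤b
  0<b+a : 0ℚ < b + a
  0<b+a = subst (_< b + a) (+-identityʳ 0ℚ) (+-mono-<-≤ (≤-<-trans 0≤a a<b) 0≤a)
  0<b-a : 0ℚ < b - a
  0<b-a = subst (_< b - a) (+-inverseʳ a) (+-monoˡ-< (- a) a<b)
  2uv≡T : (1ℚ + 1ℚ) * u * v ≡ T
  2uv≡T = trans (2*halfSum*halfDiff a b) ½[b²-a²]≡T
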